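{- Let $X$ be a finite connected vertex-transitive graph with at least $3$ vertices, and let $G$ be a group of automorphisms of $X$ acting transitively on $V(X)$ such that $G'$ is cyclic of order $p^k$ for a prime $p$, and such that $X$ is $G$-minimal. Let $H$ be a subgroup of $G'$, let $H^p=\langle h^p : h\in H\rangle$, and suppose $H^p x_1, H^p x_2, \ldots, H^p x_n, H^p x_{n+1}$ is a path in $X/H^p$ with $H^p x_1 \neq H^p x_{n+1}$. If $Hx_1, Hx_2, \ldots, Hx_n, Hx_{n+1}$ is a Hamilton cycle in $X/H$ (or if $n=2$, $X/H \cong K_2$, and $Hx_1 = Hx_3 \ne Hx_2$), then $X$ has a Hamilton cycle.
   Context: $G'$ is the commutator subgroup of $G$. For a subgroup $K$ of $G$, the quotient graph $X/K$ has the $K$-orbits $Kx=\{kx: k\in K\}$ as vertices, with $Kx$, $Ky$ adjacent iff some edge of $X$ joins a vertex of $Kx$ to a vertex of $Ky$. $X$ is $G$-minimal if every connected spanning subgraph $Y$ of $X$ with $gY=Y$ for all $g\in G$ equals $X$. -}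

module Defs where

open import Level using (Level; _⊔_)
open import Data.Nat using (ℕ; zero; suc; _+_; _≤_; _<_; _∸_)
open import Data.Fin using (Fin)
open import Data.Bool using (Bool; true; false)
open import Data.Product using (Σ; ∃; _×_; _,_)
open import Data.Sum using (_⊎_)
open import Relation.Nullary using (¬_)
open import Relation.Binary.PropositionalEquality using (_≡_)
open import Algebra.Bundles using (Group)

record Graph (N : ℕ) : Set where
  field
    adj     : Fin N → Fin N → Bool
    adj-sym : ∀ u v → adj u v ≡ adj v u
    adj-irr : ∀ u → adj u u ≡ false

Walk : {N : ℕ} → (Fin N → Fin N → Bool) → Fin N → Fin N → Set
Walk {N} E u v =
  Σ ℕ λ m → Σ (ℕ → Fin N) λ w →
    (w 0 ≡ u) × (w m ≡ v) × (∀ i → i < m → E (w i) (w (suc i)) ≡ true)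

ConnectedRel : {N : ℕ} → (Fin N → Fin N → Bool) → Set
ConnectedRel {N} E = ∀ (u v : Fin N) → Walk E u v

Connected : {N : ℕ} → Graph N → Set
Connected X = ConnectedRel (Graph.adj X)

HamiltonCycle : {N : ℕ} → Graph N → Set
HamiltonCycle {N} X =
  (3 ≤ N) × Σ (ℕ → Fin N) λ v →
    (∀ i j → i < j → j < N → ¬ (v i ≡ v j)) ×
    (∀ i → suc i < N → Graph.adj X (v i) (v (suc i)) ≡ true) ×
    (Graph.adj X (v (N ∸ 1)) (v 0) ≡ true)

-- Groups acting faithfully by automorphisms (= groups of automorphisms)

module _ {c ℓ : Level} (G : Group c ℓ) where
  open Group G

  pow : Carrier → ℕ → Carrier
  pow g zero    = ε
  pow g (suc n) = g ∙ pow g n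

  data Gen {s : Level} (S : Carrier → Set s) : Carrier → Set (c ⊔ ℓ ⊔ s) where
    gen  : ∀ {x} → S x → Gen S x
    gε   : Gen S ε
    g∙   : ∀ {x y} → Gen S x → Gen S y → Gen S (x ∙ y)
    ginv : ∀ {x} → Gen S x → Gen S (x ⁻¹)
    gresp : ∀ {x y} → x ≈ y → Gen S x → Gen S y

  Commutator : Carrier → Set (c ⊔ ℓ)
  Commutator = Gen (λ z → Σ Carrier λ a → Σ Carrier λ b → z ≈ (((a ⁻¹) ∙ (b ⁻¹)) ∙ a) ∙ b)

  PowSubgroup : {h : Level} → (Carrier → Set h) → ℕ → Carrier → Set (c ⊔ ℓ ⊔ h)
  PowSubgroup H p = Gen (λ z → Σ Carrier λ x → H x × (z ≈ pow x p))

  record IsSubgroup {h : Level} (H : Carrier → Set h) : Set (c ⊔ ℓ ⊔ h) where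
    field
      sub-ε    : H ε
      sub-∙    : ∀ {x y} → H x → H y → H (x ∙ y)
      sub-inv  : ∀ {x} → H x → H (x ⁻¹)
      sub-resp : ∀ {x y} → x ≈ y → H x → H y

  CyclicOfOrder : {s : Level} → (Carrier → Set s) → ℕ → Set (c ⊔ ℓ ⊔ s)
  CyclicOfOrder S m =
    Σ Carrier λ g → S g ×
      (∀ z → S z → Σ ℕ λ i → z ≈ pow g i) ×
      (pow g m ≈ ε) ×
      (∀ j → 0 < j → j < m → ¬ (pow g j ≈ ε))

  record AutAction {N : ℕ} (X : Graph N) : Set (c ⊔ ℓ) where
    field
      act       : Carrier → Fin N → Fin N
      act-cong  : ∀ {g h} v → g ≈ h → act g v ≡ act h v
      act-ε     : ∀ v → act ε v ≡ v
      act-∙     : ∀ g h v → act (g ∙ h) v ≡ act g (act h v)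
      act-adj   : ∀ g u v → Graph.adj X (act g u) (act g v) ≡ Graph.adj X u v
      faithful  : ∀ {g h} → (∀ v → act g v ≡ act h v) → g ≈ h

  module _ {N : ℕ} {X : Graph N} (A : AutAction X) where
    open AutAction A
    open Graph X

    Transitive : Set c
    Transitive = ∀ (u v : Fin N) → Σ Carrier λ g → act g u ≡ v

    GMinimal : Set c
    GMinimal =
      ∀ (Y : Fin N → Fin N → Bool) →
        (∀ u v → Y u v ≡ true → adj u v ≡ true) →
        (∀ u v → Y u v ≡ Y v u) →
        (∀ g u v → Y (act g u) (act g v) ≡ Y u v) →
        ConnectedRel Y →
        ∀ u v → adj u v ≡ true → Y u v ≡ true

    InOrbit : {k : Level} → (Carrier → Set k) → Fin N → Fin N → Set (c ⊔ k)
    InOrbit K x y = Σ Carrier λ g → K g × (act g x ≡ y)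

    SameOrbit : {k : Level} → (Carrier → Set k) → Fin N → Fin N → Set (c ⊔ k)
    SameOrbit K x y =
      ∀ z → (InOrbit K x z → InOrbit K y z) × (InOrbit K y z → InOrbit K x z)

    QAdj : {k : Level} → (Carrier → Set k) → Fin N → Fin N → Set (c ⊔ k)
    QAdj K x y = Σ (Fin N) λ u → Σ (Fin N) λ v →
      InOrbit K x u × InOrbit K y v × (adj u v ≡ true)

    QPath : {k : Level} → (Carrier → Set k) → ℕ → (ℕ → Fin N) → Set (c ⊔ k)
    QPath K n x =
      (∀ i → 1 ≤ i → i ≤ n → QAdj K (x i) (x (suc i))) ×
      (∀ i j → 1 ≤ i → i < j → j ≤ suc n → ¬ SameOrbit K (x i) (x j))

    QHamiltonCycle : {k : Level} → (Carrier → Set k) → ℕ → (ℕ → Fin N) → Set (c ⊔ k)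
    QHamiltonCycle K n x =
      (3 ≤ n) ×
      SameOrbit K (x (suc n)) (x 1) ×
      (∀ i j → 1 ≤ i → i < j → j ≤ n → ¬ SameOrbit K (x i) (x j)) ×
      (∀ v → Σ ℕ λ i → (1 ≤ i) × (i ≤ n) × SameOrbit K v (x i)) ×
      (∀ i → 1 ≤ i → i ≤ n → QAdj K (x i) (x (suc i)))

    QuotientIsK2 : {k : Level} → (Carrier → Set k) → Set (c ⊔ k)
    QuotientIsK2 K =
      Σ (Fin N) λ a → Σ (Fin N) λ b →
        ¬ SameOrbit K a b ×
        (∀ v → SameOrbit K v a ⊎ SameOrbit K v b) ×
        QAdj K a b

-- Lift the path Hᵖx₁ … Hᵖxₙ₊₁ to a walk y₀ … yₙ of X with yᵢ ∈ Hᵖxᵢ₊₁. As xₙ₊₁ ∈ Hx₁, we get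
-- yₙ = h y₀ for some h ∈ H, and h ∉ Hᵖ because Hᵖx₁ ≠ Hᵖxₙ₊₁. In the cyclic p-group G′ the
-- subgroups form a chain, so every z ∈ H lies in ⟨h⟩ (otherwise h ∈ ⟨zᵖ⟩ ⊆ Hᵖ); and ⟨h⟩ is normal
-- in G, so, G being transitive, ⟨h⟩ acts semiregularly. The yᵢ (i < n) then represent each
-- ⟨h⟩-orbit exactly once, and the translates h^q y₀ … h^q yₙ₋₁, for q below the period of h,
-- concatenate to a Hamilton cycle of X.

module Submission where

open import Defs
open import Level using (Level; _⊔_)
open import Algebra.Bundles using (Group)
open import Data.Bool using (true)
open import Data.Empty using (⊥-elim)
open import Data.Fin as Fin using (Fin; toℕ; fromℕ<)
open import Data.Fin.Properties using (toℕ-injective; toℕ-fromℕ<; toℕ<n; injective⇒≤)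
open import Data.Nat using (ℕ; zero; suc; pred; _+_; _*_; _^_; _∸_; _≤_; _<_; z≤n; s≤s; _≤?_; _%_; _/_)
open import Data.Nat.Properties
  using (*-comm; *-zeroʳ; *-suc; +-comm; ≤-<-connex; ≤-<-trans; ≤-trans; ≤-antisym; <-trans; <-cmp; <⇒≤; <⇒≢;
         m∸n≤m; m<n⇒0<n∸m; m∸n+n≡m; *-cancelʳ-≡; +-cancelˡ-≡; +-monoˡ-≤; *-monoˡ-≤; m≤n⇒m<n∨m≡n;
         suc-pred; m^n≢0)
open import Data.Nat.DivMod using (m≡m%n+[m/n]*n; [m+kn]%n≡m%n; m<n⇒m%n≡m; m%n<n; m<n*o⇒m/o<n)
open import Data.Nat.Divisibility using (_∣_; divides; ∣-trans; _∣?_; ∣1⇒≡1; 1∣_; *-monoʳ-∣; *-cancelˡ-∣)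
open import Data.Nat.Coprimality using (Coprime; coprime-divisor)
open import Data.Nat.GCD using (gcd; gcd[m,n]∣m; gcd[m,n]∣n; gcd-identityʳ; gcd-GCD; module Bézout)
open import Data.Nat.Primality using (Prime; prime⇒irreducible; prime⇒nonZero)
open import Data.Nat.Tactic.RingSolver using (solve-∀)
open import Data.Product using (Σ-syntax; ∃-syntax; _×_; _,_; proj₁; proj₂)
open import Data.Sum using (_⊎_; inj₁; inj₂; [_,_]′)
open import Function using (_∘_; id)
open import Relation.Binary.Definitions using (tri<; tri≈; tri>)
open import Relation.Binary.PropositionalEquality as ≡ using (_≡_; _≢_)
open import Relation.Nullary using (¬_; yes; no; Dec)

coprime-to-prime : ∀ {p d} → Prime p → ¬ p ∣ d → Coprime d p
coprime-to-prime pp ¬p∣d (e∣d , e∣p) with prime⇒irreducible pp e∣p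
... | inj₁ e≡1 = e≡1
... | inj₂ ≡.refl = ⊥-elim (¬p∣d e∣d)

∣p^k⇒≡p^i : ∀ {p} → Prime p → ∀ k {d} → d ∣ p ^ k → ∃[ i ] d ≡ p ^ i
∣p^k⇒≡p^i pp zero d∣1 = 0 , ∣1⇒≡1 d∣1
∣p^k⇒≡p^i {p} pp (suc k) {d} d∣p^[1+k] with p ∣? d
... | yes (divides e ≡.refl) =
  let instance _ = prime⇒nonZero pp
      (i , e≡p^i) = ∣p^k⇒≡p^i pp k (*-cancelˡ-∣ p (≡.subst (_∣ p * p ^ k) (*-comm e p) d∣p^[1+k]))
  in suc i , ≡.trans (*-comm e p) (≡.cong (p *_) e≡p^i)
... | no ¬p∣d = ∣p^k⇒≡p^i pp k (coprime-divisor (coprime-to-prime pp ¬p∣d) d∣p^[1+k])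

^-monoʳ-∣ : ∀ p {i j} → i ≤ j → p ^ i ∣ p ^ j
^-monoʳ-∣ p z≤n       = 1∣ _
^-monoʳ-∣ p (s≤s i≤j) = *-monoʳ-∣ p (^-monoʳ-∣ p i≤j)

least-witness : (Q : ℕ → Set) → (∀ j → Dec (Q j)) → ∀ b → Q b →
  Σ[ m ∈ ℕ ] Q m × (∀ j → j < m → ¬ Q j)
least-witness Q Q? zero    q = 0 , q , λ _ ()
least-witness Q Q? (suc b) q with Q? 0
... | yes q₀ = 0 , q₀ , λ _ ()
... | no ¬q₀ =
  let (m , qm , below) = least-witness (Q ∘ suc) (Q? ∘ suc) b q
  in suc m , qm , λ { zero _ → ¬q₀ ; (suc j) (s≤s j<m) → below j j<m }

module GroupTheory {c ℓ} (G : Group c ℓ) where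
  open Group G
  open import Relation.Binary.Reasoning.Setoid setoid

  pow-cong : ∀ n {x y} → x ≈ y → pow G x n ≈ pow G y n
  pow-cong zero    _   = refl
  pow-cong (suc n) x≈y = ∙-cong x≈y (pow-cong n x≈y)

  pow-+ : ∀ g m n → pow G g (m + n) ≈ pow G g m ∙ pow G g n
  pow-+ g zero    n = sym (identityˡ _)
  pow-+ g (suc m) n = trans (∙-congˡ (pow-+ g m n)) (sym (assoc _ _ _))

  pow-* : ∀ g m n → pow G g (m * n) ≈ pow G (pow G g m) n
  pow-* g m zero    = reflexive (≡.cong (pow G g) (*-zeroʳ m))
  pow-* g m (suc n) = begin
    pow G g (m * suc n)              ≡⟨ ≡.cong (pow G g) (*-suc m n) ⟩
    pow G g (m + m * n)              ≈⟨ pow-+ g m (m * n) ⟩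
    pow G g m ∙ pow G g (m * n)      ≈⟨ ∙-congˡ (pow-* g m n) ⟩
    pow G g m ∙ pow G (pow G g m) n  ∎

  pow-ε : ∀ n → pow G ε n ≈ ε
  pow-ε zero    = refl
  pow-ε (suc n) = trans (identityˡ _) (pow-ε n)

  pow-pow-comm : ∀ g m n → pow G (pow G g m) n ≈ pow G (pow G g n) m
  pow-pow-comm g m n =
    trans (sym (pow-* g m n)) (trans (reflexive (≡.cong (pow G g) (*-comm m n))) (pow-* g n m))

  pow-+-multiple : ∀ g P → pow G g P ≈ ε → ∀ i t → pow G g (i + t * P) ≈ pow G g i
  pow-+-multiple g P g^P≈ε i t = begin
    pow G g (i + t * P)            ≈⟨ pow-+ g i (t * P) ⟩
    pow G g i ∙ pow G g (t * P)    ≡⟨ ≡.cong (λ e → pow G g i ∙ pow G g e) (*-comm t P) ⟩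
    pow G g i ∙ pow G g (P * t)    ≈⟨ ∙-congˡ (pow-* g P t) ⟩
    pow G g i ∙ pow G (pow G g P) t ≈⟨ ∙-congˡ (trans (pow-cong t g^P≈ε) (pow-ε t)) ⟩
    pow G g i ∙ ε                  ≈⟨ identityʳ _ ⟩
    pow G g i                      ∎

  -- Only natural powers: this is ⟨g⟩ whenever g has finite order.
  infix 4 _∈⟨_⟩
  _∈⟨_⟩ : Carrier → Carrier → Set ℓ
  x ∈⟨ g ⟩ = Σ[ e ∈ ℕ ] x ≈ pow G g e

  ∈⟨⟩-resp : ∀ {x x′ g g′} → x ≈ x′ → g ≈ g′ → x ∈⟨ g ⟩ → x′ ∈⟨ g′ ⟩
  ∈⟨⟩-resp x≈x′ g≈g′ (e , x≈g^e) = e , trans (sym x≈x′) (trans x≈g^e (pow-cong e g≈g′))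

  ∈⟨⟩-trans : ∀ {x y z} → x ∈⟨ y ⟩ → y ∈⟨ z ⟩ → x ∈⟨ z ⟩
  ∈⟨⟩-trans {z = z} (a , x≈y^a) (b , y≈z^b) =
    b * a , trans x≈y^a (trans (pow-cong a y≈z^b) (sym (pow-* z b a)))

  ∈⟨⟩-powʳ : ∀ {x y} → x ∈⟨ y ⟩ → ∀ n → pow G x n ∈⟨ pow G y n ⟩
  ∈⟨⟩-powʳ {y = y} (e , x≈y^e) n = e , trans (pow-cong n x≈y^e) (pow-pow-comm y e n)

  ∈⟨ε⟩ : ∀ {x} → x ∈⟨ ε ⟩ → x ≈ ε
  ∈⟨ε⟩ (e , x≈ε^e) = trans x≈ε^e (pow-ε e)

  pow-∈⟨pow⟩ : ∀ g {d b} → d ∣ b → pow G g b ∈⟨ pow G g d ⟩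
  pow-∈⟨pow⟩ g {d} (divides q ≡.refl) = q , trans (reflexive (≡.cong (pow G g) (*-comm q d))) (pow-* g d q)

  pow-gcd-∈⟨pow⟩ : ∀ g P → pow G g P ≈ ε → ∀ a → pow G g (gcd a P) ∈⟨ pow G g a ⟩
  pow-gcd-∈⟨pow⟩ g zero _ a = 1 , trans (reflexive (≡.cong (pow G g) (gcd-identityʳ a))) (sym (identityʳ _))
  pow-gcd-∈⟨pow⟩ g (suc P′) g^P≈ε a with Bézout.identity (gcd-GCD a (suc P′))
  ... | Bézout.+- x y eq = x , (begin
    pow G g (gcd a P)           ≈⟨ pow-+-multiple g P g^P≈ε (gcd a P) y ⟨
    pow G g (gcd a P + y * P)   ≡⟨ ≡.cong (pow G g) (≡.trans eq (*-comm x a)) ⟩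
    pow G g (a * x)             ≈⟨ pow-* g a x ⟩
    pow G (pow G g a) x         ∎)
    where
    P : ℕ
    P = suc P′
  -- Here gcd a P = y P − x a, and g^(−x a) = (gᵃ)^(x (P − 1)) because gᴾ = ε.
  ... | Bézout.-+ x y eq = x * P′ , (begin
    pow G g (gcd a P)                   ≈⟨ pow-+-multiple g P g^P≈ε (gcd a P) (a * x) ⟨
    pow G g (gcd a P + a * x * P)       ≡⟨ ≡.cong (pow G g) (≡.trans (rearrange (gcd a P) a x P′) (≡.cong (a * (x * P′) +_) eq)) ⟩
    pow G g (a * (x * P′) + y * P)      ≈⟨ pow-+-multiple g P g^P≈ε (a * (x * P′)) y ⟩
    pow G g (a * (x * P′))              ≈⟨ pow-* g a (x * P′) ⟩
    pow G (pow G g a) (x * P′)          ∎)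
    where
    P : ℕ
    P = suc P′
    rearrange : ∀ d a x P′ → d + a * x * suc P′ ≡ a * (x * P′) + (d + x * a)
    rearrange = solve-∀

  powers-chain : ∀ {p} → Prime p → ∀ k g → pow G g (p ^ k) ≈ ε → ∀ a b →
    pow G g b ∈⟨ pow G g a ⟩ ⊎ pow G g a ∈⟨ pow G (pow G g b) p ⟩
  powers-chain {p} pp k g g^P≈ε a b = [ inj₁ ∘ a-below-b , inj₂ ∘ b-below-a ]′ (≤-<-connex i j)
    where
    P : ℕ
    P = p ^ k

    gcd-prime-power : ∀ c → ∃[ i ] gcd c P ≡ p ^ i
    gcd-prime-power c = ∣p^k⇒≡p^i pp k (gcd[m,n]∣n c P)

    i j : ℕ
    i = proj₁ (gcd-prime-power a)
    j = proj₁ (gcd-prime-power b)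

    gcd-a≡p^i : gcd a P ≡ p ^ i
    gcd-a≡p^i = proj₂ (gcd-prime-power a)

    gcd-b≡p^j : gcd b P ≡ p ^ j
    gcd-b≡p^j = proj₂ (gcd-prime-power b)

    a-below-b : i ≤ j → pow G g b ∈⟨ pow G g a ⟩
    a-below-b i≤j = ∈⟨⟩-trans (pow-∈⟨pow⟩ g gcd-a∣b) (pow-gcd-∈⟨pow⟩ g P g^P≈ε a)
      where
      gcd-a∣b : gcd a P ∣ b
      gcd-a∣b = ∣-trans (≡.subst₂ _∣_ (≡.sym gcd-a≡p^i) (≡.sym gcd-b≡p^j) (^-monoʳ-∣ p i≤j)) (gcd[m,n]∣m b P)

    b-below-a : j < i → pow G g a ∈⟨ pow G (pow G g b) p ⟩
    b-below-a j<i = ∈⟨⟩-trans (∈⟨⟩-resp refl (pow-* g (gcd b P) p) (pow-∈⟨pow⟩ g gcd-b*p∣a))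
                              (∈⟨⟩-powʳ (pow-gcd-∈⟨pow⟩ g P g^P≈ε b) p)
      where
      gcd-b*p∣a : gcd b P * p ∣ a
      gcd-b*p∣a = ∣-trans (≡.subst (_∣ p ^ i) (≡.trans (*-comm p _) (≡.cong (_* p) (≡.sym gcd-b≡p^j))) (^-monoʳ-∣ p j<i))
                          (≡.subst (_∣ a) gcd-a≡p^i (gcd[m,n]∣m a P))

  conj : Carrier → Carrier → Carrier
  conj g x = (g ⁻¹ ∙ x) ∙ g

  conj-cong : ∀ g {x y} → x ≈ y → conj g x ≈ conj g y
  conj-cong g x≈y = ∙-congʳ (∙-congˡ x≈y)

  conj-ε : ∀ g → conj g ε ≈ ε
  conj-ε g = trans (∙-congʳ (identityʳ _)) (inverseˡ g)

  conj-∙ : ∀ g x y → conj g (x ∙ y) ≈ conj g x ∙ conj g y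
  conj-∙ g x y = sym (begin
    ((g ⁻¹ ∙ x) ∙ g) ∙ ((g ⁻¹ ∙ y) ∙ g) ≈⟨ assoc _ _ _ ⟩
    (g ⁻¹ ∙ x) ∙ (g ∙ ((g ⁻¹ ∙ y) ∙ g)) ≈⟨ ∙-congˡ (sym (assoc _ _ _)) ⟩
    (g ⁻¹ ∙ x) ∙ ((g ∙ (g ⁻¹ ∙ y)) ∙ g) ≈⟨ ∙-congˡ (∙-congʳ (sym (assoc _ _ _))) ⟩
    (g ⁻¹ ∙ x) ∙ (((g ∙ g ⁻¹) ∙ y) ∙ g) ≈⟨ ∙-congˡ (∙-congʳ (∙-congʳ (inverseʳ g))) ⟩
    (g ⁻¹ ∙ x) ∙ ((ε ∙ y) ∙ g)          ≈⟨ ∙-congˡ (∙-congʳ (identityˡ y)) ⟩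
    (g ⁻¹ ∙ x) ∙ (y ∙ g)                ≈⟨ sym (assoc _ _ _) ⟩
    ((g ⁻¹ ∙ x) ∙ y) ∙ g                ≈⟨ ∙-congʳ (assoc _ _ _) ⟩
    (g ⁻¹ ∙ (x ∙ y)) ∙ g                ∎)

  conj-pow : ∀ g x n → conj g (pow G x n) ≈ pow G (conj g x) n
  conj-pow g x zero    = conj-ε g
  conj-pow g x (suc n) = trans (conj-∙ g x (pow G x n)) (∙-congˡ (conj-pow g x n))

  ∙-conj : ∀ g x → g ∙ conj g x ≈ x ∙ g
  ∙-conj g x = begin
    g ∙ ((g ⁻¹ ∙ x) ∙ g) ≈⟨ sym (assoc _ _ _) ⟩
    (g ∙ (g ⁻¹ ∙ x)) ∙ g ≈⟨ ∙-congʳ (sym (assoc _ _ _)) ⟩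
    ((g ∙ g ⁻¹) ∙ x) ∙ g ≈⟨ ∙-congʳ (∙-congʳ (inverseʳ g)) ⟩
    (ε ∙ x) ∙ g          ≈⟨ ∙-congʳ (identityˡ x) ⟩
    x ∙ g                ∎

  conj≈∙commutator : ∀ g x → conj g x ≈ x ∙ ((((x ⁻¹) ∙ (g ⁻¹)) ∙ x) ∙ g)
  conj≈∙commutator g x = sym (begin
    x ∙ (((x ⁻¹ ∙ g ⁻¹) ∙ x) ∙ g) ≈⟨ sym (assoc _ _ _) ⟩
    (x ∙ ((x ⁻¹ ∙ g ⁻¹) ∙ x)) ∙ g ≈⟨ ∙-congʳ (sym (assoc _ _ _)) ⟩
    ((x ∙ (x ⁻¹ ∙ g ⁻¹)) ∙ x) ∙ g ≈⟨ ∙-congʳ (∙-congʳ (sym (assoc _ _ _))) ⟩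
    (((x ∙ x ⁻¹) ∙ g ⁻¹) ∙ x) ∙ g ≈⟨ ∙-congʳ (∙-congʳ (∙-congʳ (inverseʳ x))) ⟩
    ((ε ∙ g ⁻¹) ∙ x) ∙ g          ≈⟨ ∙-congʳ (∙-congʳ (identityˡ _)) ⟩
    (g ⁻¹ ∙ x) ∙ g                ∎)

  conj-∈⟨⟩ : ∀ g {x y} → x ∈⟨ y ⟩ → conj g x ∈⟨ conj g y ⟩
  conj-∈⟨⟩ g {y = y} (e , x≈y^e) = e , trans (conj-cong g x≈y^e) (conj-pow g y e)

  conj-pow-∈⟨pow⟩ : ∀ {h} → (∀ g → conj g h ∈⟨ h ⟩) → ∀ d g → conj g (pow G h d) ∈⟨ pow G h d ⟩
  conj-pow-∈⟨pow⟩ {h} normal d g = ∈⟨⟩-resp (sym (conj-pow g h d)) refl (∈⟨⟩-powʳ (normal g) d)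

  Gen-isSubgroup : ∀ {s} {S : Carrier → Set s} → IsSubgroup G (Gen G S)
  Gen-isSubgroup = record { sub-ε = gε ; sub-∙ = g∙ ; sub-inv = ginv ; sub-resp = gresp }

  module _ {k} {K : Carrier → Set k} (K-sub : IsSubgroup G K) where
    open IsSubgroup K-sub

    pow-closed : ∀ {x} n → K x → K (pow G x n)
    pow-closed zero    _  = sub-ε
    pow-closed (suc n) kx = sub-∙ kx (pow-closed n kx)

    ∈⟨⟩-closed : ∀ {x g} → K g → x ∈⟨ g ⟩ → K x
    ∈⟨⟩-closed kg (e , x≈g^e) = sub-resp (sym x≈g^e) (pow-closed e kg)

    PowSubgroup⊆ : ∀ p {x} → PowSubgroup G K p x → K x
    PowSubgroup⊆ p (gen (y , ky , x≈y^p)) = sub-resp (sym x≈y^p) (pow-closed p ky)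
    PowSubgroup⊆ p gε                     = sub-ε
    PowSubgroup⊆ p (g∙ a b)               = sub-∙ (PowSubgroup⊆ p a) (PowSubgroup⊆ p b)
    PowSubgroup⊆ p (ginv a)               = sub-inv (PowSubgroup⊆ p a)
    PowSubgroup⊆ p (gresp x≈y a)          = sub-resp x≈y (PowSubgroup⊆ p a)

module CyclicCommutatorSubgroup {c ℓ} (G : Group c ℓ) {p k} (pp : Prime p)
  (G′-cyclic : CyclicOfOrder G (Commutator G) (p ^ k)) where
  open Group G
  open GroupTheory G

  private
    g₀ : Carrier
    g₀ = proj₁ G′-cyclic

    g₀-generates : ∀ z → Commutator G z → z ∈⟨ g₀ ⟩
    g₀-generates = proj₁ (proj₂ (proj₂ G′-cyclic))

    g₀^p^k≈ε : pow G g₀ (p ^ k) ≈ ε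
    g₀^p^k≈ε = proj₁ (proj₂ (proj₂ (proj₂ G′-cyclic)))

  commutator-chain : ∀ {h z} → Commutator G h → Commutator G z → z ∈⟨ h ⟩ ⊎ h ∈⟨ pow G z p ⟩
  commutator-chain {h} {z} ch cz with g₀-generates h ch | g₀-generates z cz
  ... | a , h≈g₀^a | b , z≈g₀^b =
    [ inj₁ ∘ ∈⟨⟩-resp (sym z≈g₀^b) (sym h≈g₀^a) , inj₂ ∘ ∈⟨⟩-resp (sym h≈g₀^a) (pow-cong p (sym z≈g₀^b)) ]′
      (powers-chain pp k g₀ g₀^p^k≈ε a b)

  commutator-pow-p^k : ∀ {x} → Commutator G x → pow G x (p ^ k) ≈ ε
  commutator-pow-p^k {x} cx with g₀-generates x cx
  ... | a , x≈g₀^a =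
    trans (pow-cong (p ^ k) x≈g₀^a) (trans (pow-pow-comm g₀ a (p ^ k)) (trans (pow-cong a g₀^p^k≈ε) (pow-ε a)))

  commutator-conj : ∀ g {x} → Commutator G x → Commutator G (conj g x)
  commutator-conj g {x} cx = gresp (sym (conj≈∙commutator g x)) (g∙ cx (gen (x , g , refl)))

  conj-root-tower : ∀ g j {x} → Commutator G x → x ∈⟨ pow G (conj g x) p ⟩ →
    Σ[ y ∈ Carrier ] Commutator G y × x ∈⟨ pow G y (p ^ j) ⟩
  conj-root-tower g zero    {x} cx _ = x , cx , 1 , trans (sym (identityʳ x)) (sym (identityʳ _))
  conj-root-tower g (suc j) {x} cx x∈⟨x′^p⟩ =
    let x′ = conj g x
        (y , cy , x′∈⟨y^p^j⟩) =
          conj-root-tower g j (commutator-conj g cx) (∈⟨⟩-resp refl (conj-pow g x′ p) (conj-∈⟨⟩ g x∈⟨x′^p⟩))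
    in y , cy , ∈⟨⟩-trans x∈⟨x′^p⟩
                  (∈⟨⟩-resp refl (trans (sym (pow-* y (p ^ j) p)) (reflexive (≡.cong (pow G y) (*-comm (p ^ j) p))))
                    (∈⟨⟩-powʳ x′∈⟨y^p^j⟩ p))

  -- If h lay in ⟨(g⁻¹hg)ᵖ⟩, conjugating k times would make h a p^k-th power of an element of G′, hence trivial.
  commutator-conj-∈⟨⟩ : ∀ {h} → Commutator G h → ∀ g → conj g h ∈⟨ h ⟩
  commutator-conj-∈⟨⟩ {h} ch g with commutator-chain ch (commutator-conj g ch)
  ... | inj₁ conj∈⟨h⟩ = conj∈⟨h⟩
  ... | inj₂ h∈⟨conj^p⟩ = 0 , trans (conj-cong g h≈ε) (conj-ε g)
    where
    tower : Σ[ y ∈ Carrier ] Commutator G y × h ∈⟨ pow G y (p ^ k) ⟩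
    tower = conj-root-tower g k ch h∈⟨conj^p⟩
    h≈ε : h ≈ ε
    h≈ε = ∈⟨ε⟩ (∈⟨⟩-resp refl (commutator-pow-p^k (proj₁ (proj₂ tower))) (proj₂ (proj₂ tower)))

module ActionTheory {c ℓ N} {X : Graph N} {G : Group c ℓ} (A : AutAction G X) where
  open Group G using (Carrier; ε; _∙_; _⁻¹; inverseˡ; sym)
  open AutAction A
  open GroupTheory G
  open ≡ using (refl; cong)

  act-pow-fix : ∀ {x u} → act x u ≡ u → ∀ r → act (pow G x r) u ≡ u
  act-pow-fix {x} {u} _       zero    = act-ε u
  act-pow-fix {x} {u} xu≡u (suc r) = ≡.trans (act-∙ x _ u) (≡.trans (cong (act x) (act-pow-fix xu≡u r)) xu≡u)

  fixes-one⇒fixes-all : Transitive G A → ∀ {x} → (∀ g → conj g x ∈⟨ x ⟩) →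
    ∀ {u} → act x u ≡ u → ∀ v → act x v ≡ v
  fixes-one⇒fixes-all transitive {x} normal {u} xu≡u v with transitive u v
  ... | g , refl with normal g
  ...   | r , conj≈x^r = begin
    act x (act g u)          ≡⟨ act-∙ x g u ⟨
    act (x ∙ g) u            ≡⟨ act-cong u (sym (∙-conj g x)) ⟩
    act (g ∙ conj g x) u     ≡⟨ act-∙ g _ u ⟩
    act g (act (conj g x) u) ≡⟨ cong (act g) (≡.trans (act-cong u conj≈x^r) (act-pow-fix xu≡u r)) ⟩
    act g u                  ∎
    where open ≡.≡-Reasoning

  module Orbits {k} {K : Carrier → Set k} (K-sub : IsSubgroup G K) where
    open IsSubgroup K-sub

    inOrbit-refl : ∀ u → InOrbit G A K u u
    inOrbit-refl u = ε , sub-ε , act-ε u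

    inOrbit-sym : ∀ {u v} → InOrbit G A K u v → InOrbit G A K v u
    inOrbit-sym {u} (g , kg , refl) = g ⁻¹ , sub-inv kg , ≡.trans (≡.sym (act-∙ _ _ u)) (≡.trans (act-cong u (inverseˡ g)) (act-ε u))

    inOrbit-trans : ∀ {u v w} → InOrbit G A K u v → InOrbit G A K v w → InOrbit G A K u w
    inOrbit-trans {u} (g , kg , refl) (g′ , kg′ , refl) = g′ ∙ g , sub-∙ kg′ kg , act-∙ g′ g u

    inOrbit⇒sameOrbit : ∀ {u v} → InOrbit G A K u v → SameOrbit G A K u v
    inOrbit⇒sameOrbit uv w = inOrbit-trans (inOrbit-sym uv) , inOrbit-trans uv

    sameOrbit⇒inOrbit : ∀ {u v} → SameOrbit G A K u v → InOrbit G A K u v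
    sameOrbit⇒inOrbit {v = v} s = proj₂ (s v) (inOrbit-refl v)

    qAdj-lift : ∀ {a b u} → QAdj G A K a b → InOrbit G A K a u →
      Σ[ v ∈ Fin N ] InOrbit G A K b v × Graph.adj X u v ≡ true
    qAdj-lift (u′ , v′ , au′ , bv′ , adj-u′v′) au with inOrbit-trans (inOrbit-sym au′) au
    ... | t , kt , refl = act t v′ , inOrbit-trans bv′ (t , kt , refl) , ≡.trans (act-adj t u′ v′) adj-u′v′

    two-orbits-cover : ∀ {a b u w} → (∀ v → SameOrbit G A K v a ⊎ SameOrbit G A K v b) →
      ¬ InOrbit G A K u w → ∀ v → InOrbit G A K u v ⊎ InOrbit G A K w v
    two-orbits-cover {a} {b} {u} {w} classify ¬uw v
      with orbit v | orbit u | orbit w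
      where
      orbit : ∀ z → InOrbit G A K z a ⊎ InOrbit G A K z b
      orbit z = [ inj₁ ∘ sameOrbit⇒inOrbit , inj₂ ∘ sameOrbit⇒inOrbit ]′ (classify z)
    ... | inj₁ va | inj₁ ua | _       = inj₁ (inOrbit-trans ua (inOrbit-sym va))
    ... | inj₁ va | inj₂ ub | inj₁ wa = inj₂ (inOrbit-trans wa (inOrbit-sym va))
    ... | inj₁ _  | inj₂ ub | inj₂ wb = ⊥-elim (¬uw (inOrbit-trans ub (inOrbit-sym wb)))
    ... | inj₂ vb | inj₂ ub | _       = inj₁ (inOrbit-trans ub (inOrbit-sym vb))
    ... | inj₂ vb | inj₁ ua | inj₂ wb = inj₂ (inOrbit-trans wb (inOrbit-sym vb))
    ... | inj₂ _  | inj₁ ua | inj₁ wa = ⊥-elim (¬uw (inOrbit-trans ua (inOrbit-sym wa)))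

module SemiregularLift {c ℓ N} {X : Graph N} {G : Group c ℓ} (A : AutAction G X) (h : Group.Carrier G) where
  open Group G using (_≈_)
  open Graph X using (adj)
  open AutAction A
  open GroupTheory G using (pow-+)
  open ≡ using (sym; trans; cong; cong₂)

  σ : ℕ → Fin N → Fin N
  σ d = act (pow G h d)

  σ-+ : ∀ a b u → σ (a + b) u ≡ σ a (σ b u)
  σ-+ a b u = trans (act-cong u (pow-+ h a b)) (act-∙ _ _ u)

  module _ (n₀ : ℕ) (y : ℕ → Fin N)
    (walk : ∀ i → i < suc n₀ → adj (y i) (y (suc i)) ≡ true)
    (closes : σ 1 (y 0) ≡ y (suc n₀))
    (e : ℕ) (h^[1+e]≈ε : pow G h (suc e) ≈ Group.ε G)
    (semiregular : ∀ d {u} → σ d u ≡ u → ∀ v → σ d v ≡ v)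
    (separates : ∀ {i j} q r → i < suc n₀ → j < suc n₀ → σ q (y i) ≡ σ r (y j) → i ≡ j)
    (covers : ∀ v → Σ[ i ∈ ℕ ] Σ[ q ∈ ℕ ] i < suc n₀ × σ q (y i) ≡ v)
    (N≥3 : 3 ≤ N)
    where

    n : ℕ
    n = suc n₀

    period-search : Σ[ m ∈ ℕ ] σ (suc m) (y 0) ≡ y 0 × (∀ j → j < m → σ (suc j) (y 0) ≢ y 0)
    period-search = least-witness (λ j → σ (suc j) (y 0) ≡ y 0) (λ j → σ (suc j) (y 0) Fin.≟ y 0)
                                  e (trans (act-cong (y 0) h^[1+e]≈ε) (act-ε (y 0)))
    m₀ m : ℕ
    m₀ = proj₁ period-search
    m = suc m₀

    σ-period : ∀ u → σ m u ≡ u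
    σ-period = semiregular m (proj₁ (proj₂ period-search))

    σ-*period : ∀ b u → σ (b * m) u ≡ u
    σ-*period zero    u = act-ε u
    σ-*period (suc b) u = trans (σ-+ m (b * m) u) (trans (cong (σ m) (σ-*period b u)) (σ-period u))

    σ-%period : ∀ q u → σ (q % m) u ≡ σ q u
    σ-%period q u = begin
      σ (q % m) u                    ≡⟨ cong (σ (q % m)) (σ-*period (q / m) u) ⟨
      σ (q % m) (σ (q / m * m) u)    ≡⟨ σ-+ (q % m) (q / m * m) u ⟨
      σ (q % m + q / m * m) u        ≡⟨ cong (λ d → σ d u) (m≡m%n+[m/n]*n q m) ⟨
      σ q u                          ∎
      where open ≡.≡-Reasoning

    σ-period-minimal : ∀ {d} → 0 < d → d < m → σ d (y 0) ≢ y 0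
    σ-period-minimal {suc d} _ (s≤s d<m₀) = proj₂ (proj₂ period-search) d d<m₀

    σ-injective-below-period : ∀ {q r} u → q < r → r < m → σ q u ≢ σ r u
    σ-injective-below-period {q} {r} u q<r r<m σqu≡σru =
      σ-period-minimal (m<n⇒0<n∸m q<r) (≤-<-trans (m∸n≤m r q) r<m) (semiregular (r ∸ q) d-fixes (y 0))
      where
      d-fixes : σ (r ∸ q) (σ q u) ≡ σ q u
      d-fixes = trans (sym (σ-+ (r ∸ q) q u)) (trans (cong (λ t → σ t u) (m∸n+n≡m (<⇒≤ q<r))) (sym σqu≡σru))

    σ-injective : ∀ {q r} u → q < m → r < m → σ q u ≡ σ r u → q ≡ r
    σ-injective {q} {r} u q<m r<m eq with <-cmp q r
    ... | tri≈ _ q≡r _ = q≡r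
    ... | tri< q<r _ _ = ⊥-elim (σ-injective-below-period u q<r r<m eq)
    ... | tri> _ _ r<q = ⊥-elim (σ-injective-below-period u r<q q<m (sym eq))

    T : ℕ
    T = m * n

    cycle : ℕ → Fin N
    cycle t = σ (t / n) (y (t % n))

    split-%/ : ∀ i q → i < n → (i + q * n) % n ≡ i × (i + q * n) / n ≡ q
    split-%/ i q i<n = rem , quot
      where
      rem : (i + q * n) % n ≡ i
      rem = trans ([m+kn]%n≡m%n i q n) (m<n⇒m%n≡m i<n)
      quot : (i + q * n) / n ≡ q
      quot = *-cancelʳ-≡ _ _ n (+-cancelˡ-≡ i _ _
               (trans (cong (_+ (i + q * n) / n * n) (sym rem)) (sym (m≡m%n+[m/n]*n (i + q * n) n))))

    cycle-split : ∀ {i} q → i < n → cycle (i + q * n) ≡ σ q (y i)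
    cycle-split q i<n = cong₂ (λ a b → σ a (y b)) (proj₂ (split-%/ _ q i<n)) (proj₁ (split-%/ _ q i<n))

    cycle-injective : ∀ {t t′} → t < T → t′ < T → cycle t ≡ cycle t′ → t ≡ t′
    cycle-injective {t} {t′} t<T t′<T eq = begin
      t                     ≡⟨ m≡m%n+[m/n]*n t n ⟩
      t % n + t / n * n     ≡⟨ cong₂ (λ a b → a + b * n) i≡i′ q≡q′ ⟩
      t′ % n + t′ / n * n   ≡⟨ m≡m%n+[m/n]*n t′ n ⟨
      t′                    ∎
      where
      open ≡.≡-Reasoning
      i≡i′ : t % n ≡ t′ % n
      i≡i′ = separates (t / n) (t′ / n) (m%n<n t n) (m%n<n t′ n) eq
      q≡q′ : t / n ≡ t′ / n
      q≡q′ = σ-injective (y (t % n)) (m<n*o⇒m/o<n t<T) (m<n*o⇒m/o<n t′<T)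
               (trans eq (cong (λ i → σ (t′ / n) (y i)) (sym i≡i′)))

    cycle-surjective : ∀ v → Σ[ t ∈ ℕ ] t < T × cycle t ≡ v
    cycle-surjective v with covers v
    ... | i , q , i<n , σqyi≡v =
      i + q % m * n , t<T , trans (cycle-split (q % m) i<n) (trans (σ-%period q (y i)) σqyi≡v)
      where
      t<T : i + q % m * n < T
      t<T = ≤-trans (+-monoˡ-≤ (q % m * n) i<n) (*-monoˡ-≤ n (m%n<n q m))

    T≡N : T ≡ N
    T≡N = ≤-antisym (injective⇒≤ cycle-injectiveᶠ) (injective⇒≤ index-injective)
      where
      cycle-injectiveᶠ : ∀ {a b : Fin T} → cycle (toℕ a) ≡ cycle (toℕ b) → a ≡ b
      cycle-injectiveᶠ eq = toℕ-injective (cycle-injective (toℕ<n _) (toℕ<n _) eq)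

      index : Fin N → Fin T
      index v = fromℕ< (proj₁ (proj₂ (cycle-surjective v)))

      cycle-index : ∀ v → cycle (toℕ (index v)) ≡ v
      cycle-index v = trans (cong cycle (toℕ-fromℕ< (proj₁ (proj₂ (cycle-surjective v))))) (proj₂ (proj₂ (cycle-surjective v)))

      index-injective : ∀ {v w} → index v ≡ index w → v ≡ w
      index-injective {v} {w} eq = trans (sym (cycle-index v)) (trans (cong (cycle ∘ toℕ) eq) (cycle-index w))

    cycle-suc : ∀ t → cycle (suc t) ≡ σ (t / n) (y (suc (t % n)))
    cycle-suc t with m≤n⇒m<n∨m≡n (m%n<n t n)
    ... | inj₁ 1+i<n = trans (cong (cycle ∘ suc) (m≡m%n+[m/n]*n t n)) (cycle-split (t / n) 1+i<n)
    ... | inj₂ 1+i≡n = begin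
      cycle (suc t)             ≡⟨ cong cycle wraps ⟩
      cycle (0 + suc q * n)     ≡⟨ cycle-split (suc q) (s≤s z≤n) ⟩
      σ (suc q) (y 0)           ≡⟨ cong (λ d → σ d (y 0)) (+-comm 1 q) ⟩
      σ (q + 1) (y 0)           ≡⟨ σ-+ q 1 (y 0) ⟩
      σ q (σ 1 (y 0))           ≡⟨ cong (σ q) (trans closes (cong y (sym 1+i≡n))) ⟩
      σ q (y (suc (t % n)))     ∎
      where
      open ≡.≡-Reasoning
      q : ℕ
      q = t / n
      wraps : suc t ≡ 0 + suc q * n
      wraps = trans (cong suc (m≡m%n+[m/n]*n t n)) (cong (_+ q * n) 1+i≡n)

    cycle-adj : ∀ t → adj (cycle t) (cycle (suc t)) ≡ true
    cycle-adj t = trans (cong (adj (cycle t)) (cycle-suc t)) (trans (act-adj (pow G h (t / n)) _ _) (walk (t % n) (m%n<n t n)))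

    cycle-T≡cycle-0 : cycle T ≡ cycle 0
    cycle-T≡cycle-0 = trans (cycle-split m (s≤s z≤n)) (trans (σ-period (y 0)) (sym (act-ε (y 0))))

    hamiltonCycle : HamiltonCycle X
    hamiltonCycle = N≥3 , cycle , distinct , (λ t _ → cycle-adj t) , closing
      where
      distinct : ∀ t t′ → t < t′ → t′ < N → cycle t ≢ cycle t′
      distinct t t′ t<t′ t′<N = <⇒≢ t<t′ ∘ cycle-injective (<-trans t<t′ t′<T) t′<T
        where
        t′<T : t′ < T
        t′<T = ≡.subst (t′ <_) (sym T≡N) t′<N
      closing : adj (cycle (N ∸ 1)) (cycle 0) ≡ true
      closing = ≡.subst (λ s → adj (cycle (s ∸ 1)) (cycle 0) ≡ true) T≡N
                  (≡.subst (λ v → adj (cycle (T ∸ 1)) v ≡ true) cycle-T≡cycle-0 (cycle-adj (T ∸ 1)))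

record ClosedTransversal {c ℓ k N} {X : Graph N} (G : Group c ℓ) (A : AutAction G X)
    (K : Group.Carrier G → Set k) (n : ℕ) (x : ℕ → Fin N) : Set (c ⊔ k) where
  field
    closes   : InOrbit G A K (x 1) (x (suc n))
    distinct : ∀ {i j} → i < n → j < n → InOrbit G A K (x (suc i)) (x (suc j)) → i ≡ j
    covers   : ∀ v → Σ[ i ∈ ℕ ] i < n × InOrbit G A K (x (suc i)) v

module _ {c ℓ k N} {X : Graph N} {G : Group c ℓ} {A : AutAction G X}
  {K : Group.Carrier G → Set k} (K-sub : IsSubgroup G K) where
  open ActionTheory A
  open Orbits K-sub

  qHamiltonCycle⇒closedTransversal : ∀ {n x} → QHamiltonCycle G A K n x → ClosedTransversal G A K n x
  qHamiltonCycle⇒closedTransversal {n} {x} (_ , closes , distinct , covers , _) = record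
    { closes   = inOrbit-sym (sameOrbit⇒inOrbit closes)
    ; distinct = distinct′
    ; covers   = covers′
    }
    where
    distinct′ : ∀ {i j} → i < n → j < n → InOrbit G A K (x (suc i)) (x (suc j)) → i ≡ j
    distinct′ {i} {j} i<n j<n xᵢ∼xⱼ with <-cmp i j
    ... | tri≈ _ i≡j _ = i≡j
    ... | tri< i<j _ _ = ⊥-elim (distinct (suc i) (suc j) (s≤s z≤n) (s≤s i<j) j<n (inOrbit⇒sameOrbit xᵢ∼xⱼ))
    ... | tri> _ _ j<i = ⊥-elim (distinct (suc j) (suc i) (s≤s z≤n) (s≤s j<i) i<n (inOrbit⇒sameOrbit (inOrbit-sym xᵢ∼xⱼ)))

    covers′ : ∀ v → Σ[ i ∈ ℕ ] i < n × InOrbit G A K (x (suc i)) v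
    covers′ v with covers v
    ... | zero  , () , _
    ... | suc i , _  , i<n , v∼xᵢ = i , i<n , inOrbit-sym (sameOrbit⇒inOrbit v∼xᵢ)

  quotientIsK2⇒closedTransversal : ∀ {x} → QuotientIsK2 G A K →
    SameOrbit G A K (x 1) (x 3) → ¬ SameOrbit G A K (x 1) (x 2) → ClosedTransversal G A K 2 x
  quotientIsK2⇒closedTransversal {x} (_ , _ , _ , classify , _) x₁∼x₃ x₁≁x₂ = record
    { closes   = sameOrbit⇒inOrbit x₁∼x₃
    ; distinct = distinct
    ; covers   = λ v → [ (λ x₁∼v → 0 , s≤s z≤n , x₁∼v) , (λ x₂∼v → 1 , s≤s (s≤s z≤n) , x₂∼v) ]′
                          (two-orbits-cover classify ¬x₁x₂ v)
    }
    where
    ¬x₁x₂ : ¬ InOrbit G A K (x 1) (x 2)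
    ¬x₁x₂ = x₁≁x₂ ∘ inOrbit⇒sameOrbit

    distinct : ∀ {i j} → i < 2 → j < 2 → InOrbit G A K (x (suc i)) (x (suc j)) → i ≡ j
    distinct {0}           {0}           _ _ _ = ≡.refl
    distinct {0}           {1}           _ _ o = ⊥-elim (¬x₁x₂ o)
    distinct {1}           {0}           _ _ o = ⊥-elim (¬x₁x₂ (inOrbit-sym o))
    distinct {1}           {1}           _ _ _ = ≡.refl
    distinct {suc (suc _)} {_} (s≤s (s≤s ())) _ _
    distinct {_} {suc (suc _)} _ (s≤s (s≤s ())) _

module QuotientLift {c ℓ hl N} {X : Graph N} {G : Group c ℓ} (A : AutAction G X)
  (transitive : Transitive G A) (N≥3 : 3 ≤ N)
  {p k} (pp : Prime p) (G′-cyclic : CyclicOfOrder G (Commutator G) (p ^ k))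
  {H : Group.Carrier G → Set hl} (H-sub : IsSubgroup G H) (H⊆G′ : ∀ g → H g → Commutator G g)
  (n₀ : ℕ) (x : ℕ → Fin N) (transversal : ClosedTransversal G A H (suc n₀) x)
  (path : ∀ i → 1 ≤ i → i ≤ suc n₀ → QAdj G A (PowSubgroup G H p) (x i) (x (suc i)))
  (open-ends : ¬ InOrbit G A (PowSubgroup G H p) (x 1) (x (suc (suc n₀))))
  where
  open Group G using (_≈_; ε; identityʳ; refl; sym; trans; reflexive)
  open Graph X using (adj)
  open AutAction A
  open GroupTheory G
  open CyclicCommutatorSubgroup G {k = k} pp G′-cyclic
  open ActionTheory A
  open ClosedTransversal transversal
  open SemiregularLift A using (σ)

  n : ℕ
  n = suc n₀

  Hᵖ : Group.Carrier G → Set (c ⊔ ℓ ⊔ hl)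
  Hᵖ = PowSubgroup G H p

  Hᵖ-sub : IsSubgroup G Hᵖ
  Hᵖ-sub = Gen-isSubgroup

  module Oᴴ = Orbits H-sub
  module Oᴴᵖ = Orbits Hᵖ-sub

  Hᵖ⇒H-orbit : ∀ {u v} → InOrbit G A Hᵖ u v → InOrbit G A H u v
  Hᵖ⇒H-orbit (g , g∈Hᵖ , gu≡v) = g , PowSubgroup⊆ H-sub p g∈Hᵖ , gu≡v

  -- Only the values at i ≤ n matter; beyond n the lift is an arbitrary filler.
  lift : ∀ i → Σ[ u ∈ Fin N ] InOrbit G A Hᵖ (x (suc i)) u
  lift zero    = x 1 , Oᴴᵖ.inOrbit-refl (x 1)
  lift (suc i) with suc i ≤? n
  ... | yes 1+i≤n = proj₁ step , proj₁ (proj₂ step)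
    where
    step : Σ[ v ∈ Fin N ] InOrbit G A Hᵖ (x (suc (suc i))) v × adj (proj₁ (lift i)) v ≡ true
    step = Oᴴᵖ.qAdj-lift (path (suc i) (s≤s z≤n) 1+i≤n) (proj₂ (lift i))
  ... | no _      = x (suc (suc i)) , Oᴴᵖ.inOrbit-refl _

  y : ℕ → Fin N
  y i = proj₁ (lift i)

  walk : ∀ i → i < n → adj (y i) (y (suc i)) ≡ true
  walk i i<n with suc i ≤? n
  ... | yes 1+i≤n = proj₂ (proj₂ (Oᴴᵖ.qAdj-lift (path (suc i) (s≤s z≤n) 1+i≤n) (proj₂ (lift i))))
  ... | no 1+i≰n  = ⊥-elim (1+i≰n i<n)

  y-orbit : ∀ i → InOrbit G A H (x (suc i)) (y i)
  y-orbit i = Hᵖ⇒H-orbit (proj₂ (lift i))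

  shift : InOrbit G A H (y 0) (y n)
  shift = Oᴴ.inOrbit-trans closes (y-orbit n)

  h : Group.Carrier G
  h = proj₁ shift

  h∈H : H h
  h∈H = proj₁ (proj₂ shift)

  h∈G′ : Commutator G h
  h∈G′ = H⊆G′ h h∈H

  h∉Hᵖ : ¬ Hᵖ h
  h∉Hᵖ h∈Hᵖ = open-ends (Oᴴᵖ.inOrbit-trans (h , h∈Hᵖ , proj₂ (proj₂ shift)) (Oᴴᵖ.inOrbit-sym (proj₂ (lift n))))

  H⊆⟨h⟩ : ∀ {z} → H z → z ∈⟨ h ⟩
  H⊆⟨h⟩ {z} z∈H with commutator-chain h∈G′ (H⊆G′ z z∈H)
  ... | inj₁ z∈⟨h⟩   = z∈⟨h⟩
  ... | inj₂ h∈⟨zᵖ⟩ = ⊥-elim (h∉Hᵖ (∈⟨⟩-closed Hᵖ-sub (gen (z , z∈H , refl)) h∈⟨zᵖ⟩))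

  σ-orbit : ∀ q u → InOrbit G A H u (σ h q u)
  σ-orbit q u = pow G h q , pow-closed H-sub q h∈H , ≡.refl

  separates : ∀ {i j} q r → i < n → j < n → σ h q (y i) ≡ σ h r (y j) → i ≡ j
  separates {i} {j} q r i<n j<n σ-eq = distinct i<n j<n
    (Oᴴ.inOrbit-trans (Oᴴ.inOrbit-trans (y-orbit i) (σ-orbit q (y i)))
      (≡.subst (λ u → InOrbit G A H u (x (suc j))) (≡.sym σ-eq)
        (Oᴴ.inOrbit-sym (Oᴴ.inOrbit-trans (y-orbit j) (σ-orbit r (y j))))))

  covers-σ : ∀ v → Σ[ i ∈ ℕ ] Σ[ q ∈ ℕ ] i < n × σ h q (y i) ≡ v
  covers-σ v with covers v
  ... | i , i<n , xᵢ∼v with Oᴴ.inOrbit-trans (Oᴴ.inOrbit-sym (y-orbit i)) xᵢ∼v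
  ...   | z , z∈H , ≡.refl with H⊆⟨h⟩ z∈H
  ...     | q , z≈h^q = i , q , i<n , act-cong (y i) (sym z≈h^q)

  semiregular : ∀ d {u} → σ h d u ≡ u → ∀ v → σ h d v ≡ v
  semiregular d = fixes-one⇒fixes-all transitive (conj-pow-∈⟨pow⟩ (commutator-conj-∈⟨⟩ h∈G′) d)

  h-finite-order : pow G h (suc (pred (p ^ k))) ≈ ε
  h-finite-order =
    trans (reflexive (≡.cong (pow G h) (suc-pred (p ^ k) {{m^n≢0 p k {{prime⇒nonZero pp}}}}))) (commutator-pow-p^k h∈G′)

  hamiltonCycle : HamiltonCycle X
  hamiltonCycle = SemiregularLift.hamiltonCycle A h n₀ y walk
    (≡.trans (act-cong (y 0) (identityʳ h)) (proj₂ (proj₂ shift)))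
    (pred (p ^ k)) h-finite-order semiregular separates covers-σ N≥3

lemma4p1 : {c ℓ h : Level} {N : ℕ} (X : Graph N) (G : Group c ℓ) (A : AutAction G X)
    (p k : ℕ) (H : Group.Carrier G → Set h) (n : ℕ) (x : ℕ → Fin N) →
    3 ≤ N → Connected X → Transitive G A →
    Prime p → CyclicOfOrder G (Commutator G) (p ^ k) →
    GMinimal G A →
    IsSubgroup G H → (∀ g → H g → Commutator G g) →
    QPath G A (PowSubgroup G H p) n x →
    ¬ SameOrbit G A (PowSubgroup G H p) (x 1) (x (suc n)) →
    (QHamiltonCycle G A H n x
      ⊎ ((n ≡ 2) × QuotientIsK2 G A H × SameOrbit G A H (x 1) (x 3) × ¬ SameOrbit G A H (x 1) (x 2))) →
    HamiltonCycle X
lemma4p1 X G A p k H zero x _ _ _ _ _ _ _ _ _ x₁≁x₁ _ = ⊥-elim (x₁≁x₁ λ _ → id , id)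
lemma4p1 X G A p k H (suc n₀) x N≥3 _ transitive pp G′-cyclic _ H-sub H⊆G′ (path , _) x₁≁xₙ₊₁ quotient-cycle =
  QuotientLift.hamiltonCycle A transitive N≥3 {k = k} pp G′-cyclic H-sub H⊆G′ n₀ x transversal path
    (x₁≁xₙ₊₁ ∘ inOrbit⇒sameOrbit)
  where
  open ActionTheory A
  open Orbits (GroupTheory.Gen-isSubgroup G) using (inOrbit⇒sameOrbit)

  transversal : ClosedTransversal G A H (suc n₀) x
  transversal = [ qHamiltonCycle⇒closedTransversal H-sub , k₂-case ]′ quotient-cycle
    where
    k₂-case : (suc n₀ ≡ 2) × QuotientIsK2 G A H × SameOrbit G A H (x 1) (x 3) × ¬ SameOrbit G A H (x 1) (x 2) →
      ClosedTransversal G A H (suc n₀) x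
    k₂-case (≡.refl , K₂ , x₁∼x₃ , x₁≁x₂) = quotientIsK2⇒closedTransversal H-sub K₂ x₁∼x₃ x₁≁x₂
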